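{- Let $G=(V,E)$ be an edge-weighted tree with distinct edge ranks, and let $D$ be its single-linkage dendrogram. Suppose the current clustering of $V$ was obtained from singleton clusters by a sequence of merges, where each merged edge was a local minimum at the time it was merged. Let $e=(u,v)$ be an edge that is a local minimum for the current clustering. Let $C$ be the union of the current clusters of $u$ and $v$. Then the parent of node $e$ in $D$ is the minimum-rank edge of $E$ with exactly one endpoint in $C$, if such an edge exists.
   Context: Each edge $e$ has a distinct rank $r_e$: its position in increasing order of weight, with ties broken consistently. The single-linkage dendrogram (SLD) $D$ is defined by the following process. Start with every vertex as a singleton cluster and process the edges in increasing order of rank; processing $e=(u,v)$ merges the current clusters of $u$ and $v$. $D$ is the rooted binary tree whose leaves are the vertices and whose internal nodes are the edges. The parent of node $e$ is the edge whose processing next merges the cluster created by $e$. Given a partition of $V$ into clusters (each a connected subtree), an edge $e=(u,v)$ joining two different clusters is a local minimum if $r_e<r_f$ for every other edge $f$ with exactly one endpoint in the cluster of $u$ or in the cluster of $v$. Merging a local-minimum edge $e$ replaces the clusters of $u$ and $v$ by their union. -}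

module Defs where

open import Data.Nat using (ℕ)
open import Data.Fin using (Fin; _<_; _≤_)
open import Data.Product using (_×_; _,_; proj₁; proj₂)
open import Data.Sum using (_⊎_)
open import Data.List using (List; _∷_; [])
open import Data.List.Membership.Propositional using (_∈_)
open import Relation.Nullary using (¬_)
open import Relation.Binary.PropositionalEquality using (_≡_; _≢_)

-- Convention: edges are indexed by their rank, i.e. edge i : Fin m has
-- rank i (its position in increasing order of weight, ties broken
-- consistently).  Hence ranks are distinct and compared by Fin's order.
record Graph (n m : ℕ) : Set where
  field
    ends : Fin m → Fin n × Fin n

module _ {n m : ℕ} (G : Graph n m) where
  open Graph G

  src tgt : Fin m → Fin n
  src i = proj₁ (ends i)
  tgt i = proj₂ (ends i)

  Joins : Fin m → Fin n → Fin n → Set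
  Joins i y z = (src i ≡ y × tgt i ≡ z) ⊎ (tgt i ≡ y × src i ≡ z)

  data Conn (S : Fin m → Set) (x : Fin n) : Fin n → Set where
    here : Conn S x x
    step : ∀ {y z} (i : Fin m) → Conn S x y → S i → Joins i y z → Conn S x z

  Connected : Set
  Connected = ∀ x y → Conn (λ _ → Fin m) x y

  -- acyclic: no edge lies on a cycle, i.e. the endpoints of every edge
  -- are not joined by a walk avoiding that edge (this also excludes loops)
  Acyclic : Set
  Acyclic = ∀ i → ¬ Conn (λ j → j ≢ i) (src i) (tgt i)

  IsTree : Set
  IsTree = Connected × Acyclic

  -- Single-linkage dendrogram.
  -- The cluster created by processing edge e is the set of vertices
  -- joined to src e by edges of rank ≤ r_e.
  CreatedCluster : Fin m → Fin n → Set
  CreatedCluster e x = Conn (λ j → j ≤ e) (src e) x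

  HasEndpointIn : (Fin n → Set) → Fin m → Set
  HasEndpointIn C f = C (src f) ⊎ C (tgt f)

  -- f is the parent of e in D: f is the next edge (after e) whose
  -- processing merges the cluster created by e.
  IsParent : Fin m → Fin m → Set
  IsParent e f =
    e < f × HasEndpointIn (CreatedCluster e) f
          × (∀ g → e < g → g < f → ¬ HasEndpointIn (CreatedCluster e) g)

  -- A clustering is represented by the
  -- list L of edges merged so far (most recent first); the cluster of x
  -- is the set of vertices joined to x by merged edges.
  ClusterOf : List (Fin m) → Fin n → Fin n → Set
  ClusterOf L x y = Conn (λ j → j ∈ L) x y

  ExactlyOneEndpointIn : (Fin n → Set) → Fin m → Set
  ExactlyOneEndpointIn C f = (C (src f) × ¬ C (tgt f)) ⊎ (¬ C (src f) × C (tgt f))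

  LocalMin : List (Fin m) → Fin m → Set
  LocalMin L e =
    ¬ ClusterOf L (src e) (tgt e)
    × (∀ f → f ≢ e →
         ExactlyOneEndpointIn (ClusterOf L (src e)) f
         ⊎ ExactlyOneEndpointIn (ClusterOf L (tgt e)) f →
         e < f)

  data ValidMerges : List (Fin m) → Set where
    start : ValidMerges []
    merge : ∀ {L e} → ValidMerges L → LocalMin L e → ValidMerges (e ∷ L)

  MergedCluster : List (Fin m) → Fin m → Fin n → Set
  MergedCluster L e x = ClusterOf L (src e) x ⊎ ClusterOf L (tgt e) x

  IsMinOutEdge : (Fin n → Set) → Fin m → Set
  IsMinOutEdge C f =
    ExactlyOneEndpointIn C f × (∀ g → ExactlyOneEndpointIn C g → f ≤ g)

{-# OPTIONS --safe #-}
module Submission where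

-- Merging local minima keeps the invariant that every merged edge ranks below
-- every edge leaving its current cluster.  Hence the union U of the clusters of
-- u and v is connected by edges of rank ≤ e, while every edge leaving U ranks
-- above e, so U is exactly the cluster created by e in D.  An edge of rank above
-- e cannot have both endpoints in U, as U is already connected by smaller edges
-- and G is acyclic; so the first edge after e touching U is the minimum edge
-- leaving U.

open import Defs
open import Data.Nat using (ℕ)
open import Data.Fin using (Fin; _<_; _<?_)
import Data.Fin.Properties as Fin
import Data.Nat.Properties as ℕ
open import Data.List using (List; _∷_)
open import Data.List.Membership.Propositional using (_∈_)
open import Data.List.Relation.Unary.Any using (here; there)
open import Data.Product using (_×_; _,_; proj₂)
open import Data.Sum using (_⊎_; inj₁; inj₂)
import Data.Sum as Sum
open import Data.Empty using (⊥-elim)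
open import Relation.Nullary using (¬_; yes; no)
open import Relation.Nullary.Decidable using (decidable-stable; ¬¬-excluded-middle)
open import Relation.Unary using (Pred; _⊆_; _≐_; _∪_)
open import Relation.Binary.PropositionalEquality using (refl; _≢_)
open import Level using (0ℓ)

module _ {n m : ℕ} (G : Graph n m) where

  private variable
    P Q : Pred (Fin m) 0ℓ
    C D : Pred (Fin n) 0ℓ
    a x y z : Fin n
    e g h i : Fin m
    L : List (Fin m)

  Joins-sym : Joins G i y z → Joins G i z y
  Joins-sym (inj₁ (s≡y , t≡z)) = inj₂ (t≡z , s≡y)
  Joins-sym (inj₂ (t≡y , s≡z)) = inj₁ (s≡z , t≡y)

  Conn-trans : Conn G P x y → Conn G P y z → Conn G P x z
  Conn-trans xy here             = xy
  Conn-trans xy (step i yw p ij) = step i (Conn-trans xy yw) p ij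

  Conn-sym : Conn G P x y → Conn G P y x
  Conn-sym here             = here
  Conn-sym (step i xw p ij) = Conn-trans (step i here p (Joins-sym ij)) (Conn-sym xw)

  Conn-mono : P ⊆ Q → Conn G P x y → Conn G Q x y
  Conn-mono P⊆Q here             = here
  Conn-mono P⊆Q (step i xw p ij) = step i (Conn-mono P⊆Q xw) (P⊆Q p) ij

  Conn-edge : P i → Conn G P (src G i) (tgt G i)
  Conn-edge p = step _ here p (inj₁ (refl , refl))

  Conn-src : Conn G P x y → P i → Joins G i y z → Conn G P x (src G i)
  Conn-src xy p (inj₁ (refl , _)) = xy
  Conn-src xy p (inj₂ (t≡y , _)) = step _ xy p (inj₂ (t≡y , refl))

  ExactlyOneEndpointIn-resp : C ≐ D → ExactlyOneEndpointIn G C i → ExactlyOneEndpointIn G D i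
  ExactlyOneEndpointIn-resp (C⊆D , D⊆C) = Sum.map
    (λ (s , ¬t) → C⊆D s , λ t → ¬t (D⊆C t))
    (λ (¬s , t) → (λ s → ¬s (D⊆C s)) , C⊆D t)

  ExactlyOneEndpointIn-∪ : ExactlyOneEndpointIn G (C ∪ D) i →
                           ExactlyOneEndpointIn G C i ⊎ ExactlyOneEndpointIn G D i
  ExactlyOneEndpointIn-∪ (inj₁ (inj₁ s , ¬t)) = inj₁ (inj₁ (s , λ t → ¬t (inj₁ t)))
  ExactlyOneEndpointIn-∪ (inj₁ (inj₂ s , ¬t)) = inj₂ (inj₁ (s , λ t → ¬t (inj₂ t)))
  ExactlyOneEndpointIn-∪ (inj₂ (¬s , inj₁ t)) = inj₁ (inj₂ ((λ s → ¬s (inj₁ s)) , t))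
  ExactlyOneEndpointIn-∪ (inj₂ (¬s , inj₂ t)) = inj₂ (inj₂ ((λ s → ¬s (inj₂ s)) , t))

  bothEndpointsIn⇒¬ExactlyOne : C (src G i) → C (tgt G i) → ¬ ExactlyOneEndpointIn G C i
  bothEndpointsIn⇒¬ExactlyOne s t (inj₁ (_ , ¬t)) = ¬t t
  bothEndpointsIn⇒¬ExactlyOne s t (inj₂ (¬s , _)) = ¬s s

  ExactlyOne⇒HasEndpointIn : ExactlyOneEndpointIn G C i → HasEndpointIn G C i
  ExactlyOne⇒HasEndpointIn = Sum.map (λ (s , _) → s) proj₂

  HasEndpointIn-mono : C ⊆ D → HasEndpointIn G C i → HasEndpointIn G D i
  HasEndpointIn-mono C⊆D = Sum.map C⊆D C⊆D

  ¬HasEndpointIn : ¬ ExactlyOneEndpointIn G C i → ¬ (C (src G i) × C (tgt G i)) →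
                   ¬ HasEndpointIn G C i
  ¬HasEndpointIn ¬one ¬both (inj₁ s) = ¬one (inj₁ (s , λ t → ¬both (s , t)))
  ¬HasEndpointIn ¬one ¬both (inj₂ t) = ¬one (inj₂ ((λ s → ¬both (s , t)) , t))

  ¬HasEndpointIn-¬¬⊆ : (∀ {x} → C x → ¬ ¬ D x) → ¬ HasEndpointIn G D i → ¬ HasEndpointIn G C i
  ¬HasEndpointIn-¬¬⊆ C⊆¬¬D ¬D (inj₁ s) = C⊆¬¬D s (λ s → ¬D (inj₁ s))
  ¬HasEndpointIn-¬¬⊆ C⊆¬¬D ¬D (inj₂ t) = C⊆¬¬D t (λ t → ¬D (inj₂ t))

  Joins⇒ExactlyOneEndpointIn : Joins G i y z → C y → ¬ C z → ExactlyOneEndpointIn G C i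
  Joins⇒ExactlyOneEndpointIn (inj₁ (refl , refl)) y ¬z = inj₁ (y , ¬z)
  Joins⇒ExactlyOneEndpointIn (inj₂ (refl , refl)) y ¬z = inj₂ (¬z , y)

  Conn-¬¬-closed : (∀ {i} → P i → ¬ ExactlyOneEndpointIn G C i) →
                   C x → Conn G P x y → ¬ ¬ C y
  Conn-¬¬-closed noExit cx here             ¬cy = ¬cy cx
  Conn-¬¬-closed noExit cx (step i xw p ij) ¬cz =
    Conn-¬¬-closed noExit cx xw λ cw → noExit p (Joins⇒ExactlyOneEndpointIn ij cw ¬cz)

  ClusterOf-∷ : ClusterOf G L x y → ClusterOf G (e ∷ L) x y
  ClusterOf-∷ = Conn-mono there

  ClusterOf-≐ : ClusterOf G L a x → ClusterOf G L a ≐ ClusterOf G L x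
  ClusterOf-≐ ax = Conn-trans (Conn-sym ax) , Conn-trans ax

  MergedCluster-step : MergedCluster G L e y → i ∈ L → Joins G i y z → MergedCluster G L e z
  MergedCluster-step (inj₁ sy) i∈L ij = inj₁ (step _ sy i∈L ij)
  MergedCluster-step (inj₂ ty) i∈L ij = inj₂ (step _ ty i∈L ij)

  ClusterOf-merge-inside : MergedCluster G L e a → ClusterOf G (e ∷ L) a ≐ MergedCluster G L e
  ClusterOf-merge-inside {L} {e} {a} ua = toMerged , λ ux → Conn-trans (Conn-sym (fromSrc ua)) (fromSrc ux)
    where
    toMerged : ClusterOf G (e ∷ L) a x → MergedCluster G L e x
    toMerged here                                         = ua
    toMerged (step i aw (there i∈L) iw)                   = MergedCluster-step (toMerged aw) i∈L iw
    toMerged (step i aw (here refl) (inj₁ (refl , refl))) = inj₂ here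
    toMerged (step i aw (here refl) (inj₂ (refl , refl))) = inj₁ here

    fromSrc : MergedCluster G L e x → ClusterOf G (e ∷ L) (src G e) x
    fromSrc (inj₁ sx) = ClusterOf-∷ sx
    fromSrc (inj₂ tx) = Conn-trans (Conn-edge (here refl)) (ClusterOf-∷ tx)

  ClusterOf-merge-outside : ¬ MergedCluster G L e a → ClusterOf G (e ∷ L) a ≐ ClusterOf G L a
  ClusterOf-merge-outside {L} {e} {a} ¬ua = fromMerged , ClusterOf-∷
    where
    fromMerged : ClusterOf G (e ∷ L) a x → ClusterOf G L a x
    fromMerged here                                         = here
    fromMerged (step i aw (there i∈L) iw)                   = step i (fromMerged aw) i∈L iw
    fromMerged (step i aw (here refl) (inj₁ (refl , refl))) =
      ⊥-elim (¬ua (inj₁ (Conn-sym (fromMerged aw))))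
    fromMerged (step i aw (here refl) (inj₂ (refl , refl))) =
      ⊥-elim (¬ua (inj₂ (Conn-sym (fromMerged aw))))

  separated⇒leaves-src-cluster : ¬ ClusterOf G L (src G e) (tgt G e) →
                               ExactlyOneEndpointIn G (ClusterOf G L (src G e)) e
  separated⇒leaves-src-cluster ¬st = inj₁ (here , ¬st)

  separated⇒leaves-tgt-cluster : ¬ ClusterOf G L (src G e) (tgt G e) →
                               ExactlyOneEndpointIn G (ClusterOf G L (tgt G e)) e
  separated⇒leaves-tgt-cluster ¬st = inj₂ ((λ ts → ¬st (Conn-sym ts)) , here)

  LocalMin⇒<outEdge : LocalMin G L e → ExactlyOneEndpointIn G (MergedCluster G L e) h → e < h
  LocalMin⇒<outEdge {L} {e} {h} (_ , minimal) out =
    minimal h h≢e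
      (ExactlyOneEndpointIn-∪ {C = ClusterOf G L (src G e)} {D = ClusterOf G L (tgt G e)} out)
    where
    h≢e : h ≢ e
    h≢e refl = bothEndpointsIn⇒¬ExactlyOne {C = MergedCluster G L e} (inj₁ here) (inj₂ here) out

  MergesBelowOutEdges : List (Fin m) → Set
  MergesBelowOutEdges L =
    ∀ {g h} → g ∈ L → ExactlyOneEndpointIn G (ClusterOf G L (src G g)) h → g < h

  ClusterOf⇒Conn-below-outEdge : MergesBelowOutEdges L →
    ExactlyOneEndpointIn G (ClusterOf G L a) h → ClusterOf G L a x → Conn G (_< h) a x
  ClusterOf⇒Conn-below-outEdge below out here = here
  ClusterOf⇒Conn-below-outEdge below out (step i aw i∈L iw) =
    step i (ClusterOf⇒Conn-below-outEdge below out aw)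
           (below i∈L (ExactlyOneEndpointIn-resp (ClusterOf-≐ (Conn-src aw i∈L iw)) out)) iw

  mergedEdge<localMin : MergesBelowOutEdges L → LocalMin G L e →
    g ∈ L → MergedCluster G L e (src G g) → g < e
  mergedEdge<localMin below (¬st , _) g∈L (inj₁ sg) =
    below g∈L (ExactlyOneEndpointIn-resp (ClusterOf-≐ sg) (separated⇒leaves-src-cluster ¬st))
  mergedEdge<localMin below (¬st , _) g∈L (inj₂ tg) =
    below g∈L (ExactlyOneEndpointIn-resp (ClusterOf-≐ tg) (separated⇒leaves-tgt-cluster ¬st))

  -- Whether src g lies in the merged cluster is not decidable, but g < h is,
  -- so the case split may be done under a double negation.
  MergesBelowOutEdges-merge : MergesBelowOutEdges L → LocalMin G L e → MergesBelowOutEdges (e ∷ L)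
  MergesBelowOutEdges-merge below lm (here refl) out =
    LocalMin⇒<outEdge lm (ExactlyOneEndpointIn-resp (ClusterOf-merge-inside (inj₁ here)) out)
  MergesBelowOutEdges-merge below lm {g} {h} (there g∈L) out =
    decidable-stable (g <? h) λ g≮h → ¬¬-excluded-middle λ where
      (yes ug) → g≮h (ℕ.<-trans (mergedEdge<localMin below lm g∈L ug)
        (LocalMin⇒<outEdge lm (ExactlyOneEndpointIn-resp (ClusterOf-merge-inside ug) out)))
      (no ¬ug) → g≮h (below g∈L (ExactlyOneEndpointIn-resp (ClusterOf-merge-outside ¬ug) out))

  ValidMerges⇒MergesBelowOutEdges : ValidMerges G L → MergesBelowOutEdges L
  ValidMerges⇒MergesBelowOutEdges start         ()
  ValidMerges⇒MergesBelowOutEdges (merge vm lm) =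
    MergesBelowOutEdges-merge (ValidMerges⇒MergesBelowOutEdges vm) lm

  MergedCluster⊆CreatedCluster : MergesBelowOutEdges L → LocalMin G L e →
                                 MergedCluster G L e ⊆ CreatedCluster G e
  MergedCluster⊆CreatedCluster below (¬st , _) (inj₁ sx) =
    Conn-mono ℕ.<⇒≤ (ClusterOf⇒Conn-below-outEdge below (separated⇒leaves-src-cluster ¬st) sx)
  MergedCluster⊆CreatedCluster below (¬st , _) (inj₂ tx) =
    Conn-trans (Conn-edge ℕ.≤-refl)
      (Conn-mono ℕ.<⇒≤ (ClusterOf⇒Conn-below-outEdge below (separated⇒leaves-tgt-cluster ¬st) tx))

  CreatedCluster⊆¬¬MergedCluster : LocalMin G L e → CreatedCluster G e x → ¬ ¬ MergedCluster G L e x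
  CreatedCluster⊆¬¬MergedCluster lm =
    Conn-¬¬-closed (λ i≤e out → ℕ.<⇒≱ (LocalMin⇒<outEdge lm out) i≤e) (inj₁ here)

lemma4p2 : ∀ {n m : ℕ} (G : Graph n m) → IsTree G →
    (L : List (Fin m)) → ValidMerges G L →
    (e : Fin m) → LocalMin G L e →
    ∀ f → IsMinOutEdge G (MergedCluster G L e) f → IsParent G e f
lemma4p2 G (_ , acyclic) L merges e lm f (f-out , f-min) =
  LocalMin⇒<outEdge G lm f-out ,
  HasEndpointIn-mono G {C = U} U⊆created (ExactlyOne⇒HasEndpointIn G {C = U} f-out) ,
  noEndpointBetween
  where
  U : Fin _ → Set
  U = MergedCluster G L e

  U⊆created : U ⊆ CreatedCluster G e
  U⊆created = MergedCluster⊆CreatedCluster G (ValidMerges⇒MergesBelowOutEdges G merges) lm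

  noEndpointBetween : ∀ g → e < g → g < f → ¬ HasEndpointIn G (CreatedCluster G e) g
  noEndpointBetween g e<g g<f =
    ¬HasEndpointIn-¬¬⊆ G {C = CreatedCluster G e} {D = U} (CreatedCluster⊆¬¬MergedCluster G lm)
      (¬HasEndpointIn G {C = U} ¬leaves ¬inside)
    where
    ¬leaves : ¬ ExactlyOneEndpointIn G U g
    ¬leaves out = ℕ.<⇒≱ g<f (f-min g out)

    ¬inside : ¬ (U (src G g) × U (tgt G g))
    ¬inside (us , ut) = acyclic g (Conn-mono G (λ j≤e → Fin.<⇒≢ (ℕ.≤-<-trans j≤e e<g))
                                    (Conn-trans G (Conn-sym G (U⊆created us)) (U⊆created ut)))
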